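{- Let $q\ge 19$ be an odd prime and let $H$ be an integer with $\lfloor (q-1)/3\rfloor\le H\le (q-1)/2$. Let $\mathcal{V}_H=\{(1,i,i^2): i=0,1,\dots,H\}$, $P=(0,1,0)$, $T_H=(0,1,b_H)$ where $b_H=2H+1$ if $H=\lfloor (q-1)/3\rfloor$ and $b_H=2H$ if $\lfloor (q-1)/3\rfloor<H\le (q-1)/2$. Then $\mathcal{K}_H=\mathcal{V}_H\cup\{P,T_H\}$ is an $(H+3)$-arc in $PG(2,q)$.
   Context: Points of $PG(2,q)$ are in homogeneous coordinates $(x_0,x_1,x_2)$; integers are read modulo $q$ as elements of $F_q$. An arc is a set of points no three of which are collinear. -}

module Defs where

open import Data.Nat as ℕ using (ℕ; suc; _∸_)
open import Data.Integer as ℤ using (ℤ; +_; _+_; _*_; _-_)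
open import Data.Integer.Divisibility using (_∣_)
open import Data.Product using (_×_; Σ; ∃; _,_)
open import Data.Fin using (Fin)
open import Data.List using (List; _∷_; []; _++_; map; upTo; length; lookup)
open import Relation.Binary.PropositionalEquality using (_≡_; _≢_)
open import Relation.Nullary using (¬_; yes; no)

-- Homogeneous coordinates; integers are read modulo q.
Point : Set
Point = ℤ × ℤ × ℤ

_≡[_]_ : ℤ → ℕ → ℤ → Set
a ≡[ q ] b = (+ q) ∣ (a - b)

IsPoint : ℕ → Point → Set
IsPoint q (x , y , z) = ¬ ((+ q ∣ x) × (+ q ∣ y) × (+ q ∣ z))

SamePoint : ℕ → Point → Point → Set
SamePoint q (x , y , z) (x' , y' , z') =
  Σ ℤ λ c → ¬ (+ q ∣ c) × (x ≡[ q ] (c * x')) × (y ≡[ q ] (c * y')) × (z ≡[ q ] (c * z'))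

-- point (x,y,z) lies on line [a,b,c] : ax + by + cz = 0 in F_q
Incident : ℕ → Point → Point → Set
Incident q (a , b , c) (x , y , z) = + q ∣ (a * x + b * y + c * z)

Collinear : ℕ → Point → Point → Point → Set
Collinear q u v w =
  Σ Point λ ℓ → IsPoint q ℓ × Incident q ℓ u × Incident q ℓ v × Incident q ℓ w

IsKArc : ℕ → ℕ → List Point → Set
IsKArc q k L =
  (length L ≡ k)
  × (∀ (i : Fin (length L)) → IsPoint q (lookup L i))
  × (∀ (i j : Fin (length L)) → i ≢ j → ¬ SamePoint q (lookup L i) (lookup L j))
  × (∀ (i j k : Fin (length L)) → i ≢ j → j ≢ k → i ≢ k →
       ¬ Collinear q (lookup L i) (lookup L j) (lookup L k))

V : ℕ → List Point
V H = map (λ i → (+ 1 , + i , + (i ℕ.* i))) (upTo (suc H))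

P : Point
P = (+ 0 , + 1 , + 0)

b : ℕ → ℕ → ℕ
b q H with H ℕ.≟ ((q ∸ 1) ℕ./ 3)
... | yes _ = 2 ℕ.* H ℕ.+ 1
... | no _ = 2 ℕ.* H

T : ℕ → ℕ → Point
T q H = (+ 0 , + 1 , + b q H)

K : ℕ → ℕ → List Point
K q H = V H ++ (P ∷ T q H ∷ [])

-- Three points on a common line of PG(2,q) have determinant ≡ 0 (mod q):
-- each coordinate of the line times the determinant is an integer combination
-- of the three incidence sums, and some coordinate of the line is nonzero, so
-- Euclid's lemma applies.  For the conic points (1,i,i²) and the "ideal" points
-- (0,1,γ) on the line x₀ = 0 the determinants factor completely:
--   det(conic i, conic j, conic k)    = (j-i)(k-i)(k-j),
--   det(conic i, conic j, ideal γ)    = (j-i)(γ-(i+j)),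
--   det(conic i, ideal γ, ideal δ)    = δ-γ,
-- i.e. the chord through (1,i,i²) and (1,j,j²) meets x₀ = 0 in (0,1,i+j).  Each
-- factor is a difference of two distinct naturals below q, hence nonzero mod q.
--
-- ConicArcs.ConicArc proves, for any prime q and any β with 0 < β, 2H ≤ β < q,
-- that V_H ∪ {(0,1,0), (0,1,β)} is an (H+3)-arc: the two ideal values 0 and β
-- avoid every chord value i+j (0 < i+j < 2H).
module Submission where

open import Defs

module ConicArcs where

  open import Data.Nat as ℕ using (ℕ; zero; suc; _≤_; _<_; z≤n; s≤s)
  open import Data.Nat.Properties
    using (<-cmp; <⇒≱; ≤-<-trans; <-≤-trans; m<n⇒0<n∸m; m∸n≤m; m≤m+n;
           +-mono-<-≤; +-mono-≤-<; <-trans; +-suc; ≤-pred)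
  open import Data.Nat.Base using (nonTrivial⇒n>1)
  open import Data.Nat.Divisibility using (∣⇒≤) renaming (_∣_ to _∣ℕ_)
  open import Data.Nat.Primality using (Prime; euclidsLemma; prime⇒nonTrivial)
  open import Data.Integer using (ℤ; +_; _+_; _*_; _-_; -_; ∣_∣)
  open import Data.Integer.Properties
    using (abs-*; m-n≡m⊖n; ∣⊖∣-<; ∣i-j∣≡∣j-i∣; ∣-i∣≡∣i∣; pos-+; pos-*)
  open import Data.Integer.Divisibility using (_∣_)
  import Data.Integer.Divisibility.Signed as Signed
  open import Data.Integer.Tactic.RingSolver using (solve-∀)
  open import Data.Fin using (Fin; toℕ; zero; suc)
  open import Data.Fin.Properties using (toℕ<n; toℕ-injective)
  open import Data.List using (List; []; _∷_; _++_; length; lookup; map; upTo)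
  open import Data.List.Properties using (length-map; length-upTo; lookup-upTo; length-++)
  open import Data.Product using (Σ; _×_; _,_)
  open import Data.Sum using (_⊎_; inj₁; inj₂; [_,_]′)
  open import Data.Empty using (⊥; ⊥-elim)
  open import Function using (_∘_; id)
  open import Relation.Binary.Definitions using (tri<; tri≈; tri>)
  open import Relation.Binary.PropositionalEquality
    using (_≡_; _≢_; refl; sym; trans; cong; subst; subst₂)
  open import Relation.Nullary using (¬_; contradiction)

  -- Residues modulo q.  In Defs, 'x ≡ 0 in F_q' is '+ q ∣ x' (divisibility of
  -- absolute values); the signed divisibility relation has the algebraic laws.

  small-∤ : ∀ {q m} → 0 < m → m < q → ¬ (+ q ∣ + m)
  small-∤ {m = suc _} _ m<q q∣m = <⇒≱ m<q (∣⇒≤ q∣m)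

  -- For k < l < q the difference k - l is nonzero mod q: its absolute value is l ∸ k.
  ordered-∤ : ∀ {q k l} → k < l → l < q → ¬ (+ q ∣ (+ k - + l))
  ordered-∤ {q} {k} {l} k<l l<q q∣k-l =
    small-∤ (m<n⇒0<n∸m k<l) (≤-<-trans (m∸n≤m l k) l<q)
      (subst (q ∣ℕ_) (trans (cong ∣_∣ (m-n≡m⊖n k l)) (∣⊖∣-< k<l)) q∣k-l)

  distinct-∤ : ∀ {q m n} → m ≢ n → m < q → n < q → ¬ (+ q ∣ (+ m - + n))
  distinct-∤ {q} {m} {n} m≢n m<q n<q with <-cmp m n
  ... | tri< m<n _ _ = ordered-∤ m<n n<q
  ... | tri≈ _ m≡n _ = contradiction m≡n m≢n
  ... | tri> _ _ n<m = ordered-∤ n<m m<q ∘ subst (q ∣ℕ_) (∣i-j∣≡∣j-i∣ (+ m) (+ n))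

  euclid : ∀ {q} → Prime q → ∀ x y → + q ∣ (x * y) → (+ q ∣ x) ⊎ (+ q ∣ y)
  euclid {q} pq x y q∣xy = euclidsLemma ∣ x ∣ ∣ y ∣ pq (subst (q ∣ℕ_) (abs-* x y) q∣xy)

  product-∤ : ∀ {q} → Prime q → ∀ x y → ¬ (+ q ∣ x) → ¬ (+ q ∣ y) → ¬ (+ q ∣ (x * y))
  product-∤ pq x y q∤x q∤y = [ q∤x , q∤y ]′ ∘ euclid pq x y

  prime⇒1< : ∀ {q} → Prime q → 1 < q
  prime⇒1< {q} pq = nonTrivial⇒n>1 q {{prime⇒nonTrivial pq}}

  toSigned : ∀ {q} x → + q ∣ x → + q Signed.∣ x
  toSigned {q} x = Signed.∣ᵤ⇒∣ {+ q} {x}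

  negate-∣ : ∀ {q} x → + q ∣ (- x) → + q ∣ x
  negate-∣ {q} x = subst (q ∣ℕ_) (∣-i∣≡∣i∣ x)

  combination-∣ : ∀ {q} su sv sw X Y Z → + q ∣ su → + q ∣ sv → + q ∣ sw →
                  + q ∣ (su * X - sv * Y + sw * Z)
  combination-∣ {q} su sv sw X Y Z q∣su q∣sv q∣sw = Signed.∣⇒∣ᵤ
    (Signed.∣m∣n⇒∣m+n (Signed.∣m∣n⇒∣m-n (Signed.∣m⇒∣m*n X (toSigned su q∣su))
                                         (Signed.∣m⇒∣m*n Y (toSigned sv q∣sv)))
                      (Signed.∣m⇒∣m*n Z (toSigned sw q∣sw)))

  det : Point → Point → Point → ℤ
  det (u0 , u1 , u2) (v0 , v1 , v2) (w0 , w1 , w2) =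
    u0 * (v1 * w2 - v2 * w1) - u1 * (v0 * w2 - v2 * w0) + u2 * (v0 * w1 - v1 * w0)

  -- Cofactor identities: for a line ℓ = [a,b,c], each coordinate of ℓ times
  -- det(u,v,w) (written out, as the ring solver needs) is a combination of the
  -- incidence sums ℓ·u, ℓ·v, ℓ·w.
  cofactor₀ : ∀ a b c u0 u1 u2 v0 v1 v2 w0 w1 w2 →
    a * (u0 * (v1 * w2 - v2 * w1) - u1 * (v0 * w2 - v2 * w0) + u2 * (v0 * w1 - v1 * w0))
    ≡ (a * u0 + b * u1 + c * u2) * (v1 * w2 - v2 * w1) - (a * v0 + b * v1 + c * v2) * (u1 * w2 - u2 * w1)
      + (a * w0 + b * w1 + c * w2) * (u1 * v2 - u2 * v1)
  cofactor₀ = solve-∀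

  cofactor₁ : ∀ a b c u0 u1 u2 v0 v1 v2 w0 w1 w2 →
    b * (u0 * (v1 * w2 - v2 * w1) - u1 * (v0 * w2 - v2 * w0) + u2 * (v0 * w1 - v1 * w0))
    ≡ (a * u0 + b * u1 + c * u2) * (v2 * w0 - v0 * w2) - (a * v0 + b * v1 + c * v2) * (u2 * w0 - u0 * w2)
      + (a * w0 + b * w1 + c * w2) * (u2 * v0 - u0 * v2)
  cofactor₁ = solve-∀

  cofactor₂ : ∀ a b c u0 u1 u2 v0 v1 v2 w0 w1 w2 →
    c * (u0 * (v1 * w2 - v2 * w1) - u1 * (v0 * w2 - v2 * w0) + u2 * (v0 * w1 - v1 * w0))
    ≡ (a * u0 + b * u1 + c * u2) * (v0 * w1 - v1 * w0) - (a * v0 + b * v1 + c * v2) * (u0 * w1 - u1 * w0)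
      + (a * w0 + b * w1 + c * w2) * (u0 * v1 - u1 * v0)
  cofactor₂ = solve-∀

  -- Three points whose determinant is nonzero mod q are not collinear: otherwise
  -- every coordinate of the common line would vanish mod q.
  det-noncollinear : ∀ {q} → Prime q → ∀ u v w → ¬ (+ q ∣ det u v w) → ¬ Collinear q u v w
  det-noncollinear {q} pq u@(u0 , u1 , u2) v@(v0 , v1 , v2) w@(w0 , w1 , w2) q∤Δ
    ((a , b , c) , line≠0 , ℓ∣u , ℓ∣v , ℓ∣w) =
      line≠0 ( coordinate a (cofactor₀ a b c u0 u1 u2 v0 v1 v2 w0 w1 w2)
             , coordinate b (cofactor₁ a b c u0 u1 u2 v0 v1 v2 w0 w1 w2)
             , coordinate c (cofactor₂ a b c u0 u1 u2 v0 v1 v2 w0 w1 w2))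
    where
    su = a * u0 + b * u1 + c * u2
    sv = a * v0 + b * v1 + c * v2
    sw = a * w0 + b * w1 + c * w2
    coordinate : ∀ k {X Y Z} → k * det u v w ≡ su * X - sv * Y + sw * Z → + q ∣ k
    coordinate k {X} {Y} {Z} eq =
      [ id , ⊥-elim ∘ q∤Δ ]′ (euclid pq k (det u v w)
        (subst (+ q ∣_) (sym eq) (combination-∣ su sv sw X Y Z ℓ∣u ℓ∣v ℓ∣w)))

  collinear-swap₁₂ : ∀ {q u v w} → Collinear q u v w → Collinear q v u w
  collinear-swap₁₂ (ℓ , ℓ≠0 , ℓu , ℓv , ℓw) = ℓ , ℓ≠0 , ℓv , ℓu , ℓw

  collinear-swap₂₃ : ∀ {q u v w} → Collinear q u v w → Collinear q u w v
  collinear-swap₂₃ (ℓ , ℓ≠0 , ℓu , ℓv , ℓw) = ℓ , ℓ≠0 , ℓu , ℓw , ℓv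

  conic : ℕ → Point
  conic n = (+ 1 , + n , + (n ℕ.* n))

  ideal : ℤ → Point
  ideal γ = (+ 0 , + 1 , γ)

  det-conic³ : ∀ i j k → det (conic i) (conic j) (conic k) ≡ (+ j - + i) * ((+ k - + i) * (+ k - + j))
  det-conic³ i j k = squares (+ i) (+ j) (+ k) _ _ _ (pos-* i i) (pos-* j j) (pos-* k k)
    where
    -- the solver needs the squares as products of integers
    squares : ∀ x y z x² y² z² → x² ≡ x * x → y² ≡ y * y → z² ≡ z * z →
      det (+ 1 , x , x²) (+ 1 , y , y²) (+ 1 , z , z²) ≡ (y - x) * ((z - x) * (z - y))
    squares x y z _ _ _ refl refl refl = vandermonde x y z
      where
      vandermonde : ∀ x y z →
        + 1 * (y * (z * z) - (y * y) * z) - x * (+ 1 * (z * z) - (y * y) * + 1)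
          + (x * x) * (+ 1 * z - y * + 1)
        ≡ (y - x) * ((z - x) * (z - y))
      vandermonde = solve-∀

  -- The chord through conic i and conic j meets x₀ = 0 in (0,1,i+j).
  det-conic²-ideal : ∀ i j γ → det (conic i) (conic j) (ideal γ) ≡ (+ j - + i) * (γ - + (i ℕ.+ j))
  det-conic²-ideal i j γ = squares (+ i) (+ j) _ _ _ (pos-* i i) (pos-* j j) (pos-+ i j)
    where
    squares : ∀ x y x² y² s → x² ≡ x * x → y² ≡ y * y → s ≡ x + y →
      det (+ 1 , x , x²) (+ 1 , y , y²) (ideal γ) ≡ (y - x) * (γ - s)
    squares x y _ _ _ refl refl refl = chord x y γ
      where
      chord : ∀ x y γ →
        + 1 * (y * γ - (y * y) * + 1) - x * (+ 1 * γ - (y * y) * + 0) + (x * x) * (+ 1 * + 1 - y * + 0)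
        ≡ (y - x) * (γ - (x + y))
      chord = solve-∀

  det-conic-ideal² : ∀ i γ δ → det (conic i) (ideal γ) (ideal δ) ≡ δ - γ
  det-conic-ideal² i γ δ = expanded (+ i) (+ (i ℕ.* i)) γ δ
    where
    expanded : ∀ x x² γ δ →
      + 1 * (+ 1 * δ - γ * + 1) - x * (+ 0 * δ - γ * + 0) + x² * (+ 0 * + 1 - + 1 * + 0) ≡ δ - γ
    expanded = solve-∀

  unit-scalar : ∀ {q} c x y → + q ∣ (+ 1 - c * + 1) → + q ∣ (x - c * y) → + q ∣ (x - y)
  unit-scalar {q} c x y q∣1-c q∣x-cy = subst (+ q ∣_) (identity c x y)
    (Signed.∣⇒∣ᵤ (Signed.∣m∣n⇒∣m-n (toSigned (x - c * y) q∣x-cy)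
                                   (Signed.∣n⇒∣m*n y (toSigned (+ 1 - c * + 1) q∣1-c))))
    where
    identity : ∀ c x y → (x - c * y) - y * (+ 1 - c * + 1) ≡ x - y
    identity = solve-∀

  module _ {q : ℕ} (pq : Prime q) where

    -- Non-collinearity over F_q: every factor of the determinant is a
    -- difference of two distinct naturals below q.
    conic³-noncollinear : ∀ {i j k} → i ≢ j → j ≢ k → i ≢ k → i < q → j < q → k < q →
                          ¬ Collinear q (conic i) (conic j) (conic k)
    conic³-noncollinear {i} {j} {k} i≢j j≢k i≢k i<q j<q k<q =
      det-noncollinear pq (conic i) (conic j) (conic k)
        (product-∤ pq (+ j - + i) _ (distinct-∤ (i≢j ∘ sym) j<q i<q)
           (product-∤ pq (+ k - + i) (+ k - + j) (distinct-∤ (i≢k ∘ sym) k<q i<q) (distinct-∤ (j≢k ∘ sym) k<q j<q))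
         ∘ subst (+ q ∣_) (det-conic³ i j k))

    conic²-ideal-noncollinear : ∀ {i j γ} → i ≢ j → i < q → j < q → γ ≢ i ℕ.+ j → γ < q → i ℕ.+ j < q →
                                ¬ Collinear q (conic i) (conic j) (ideal (+ γ))
    conic²-ideal-noncollinear {i} {j} {γ} i≢j i<q j<q γ≢i+j γ<q i+j<q =
      det-noncollinear pq (conic i) (conic j) (ideal (+ γ))
        (product-∤ pq (+ j - + i) (+ γ - + (i ℕ.+ j)) (distinct-∤ (i≢j ∘ sym) j<q i<q) (distinct-∤ γ≢i+j γ<q i+j<q)
         ∘ subst (+ q ∣_) (det-conic²-ideal i j (+ γ)))

    conic-ideal²-noncollinear : ∀ {i γ δ} → γ ≢ δ → γ < q → δ < q →
                                ¬ Collinear q (conic i) (ideal (+ γ)) (ideal (+ δ))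
    conic-ideal²-noncollinear {i} {γ} {δ} γ≢δ γ<q δ<q =
      det-noncollinear pq (conic i) (ideal (+ γ)) (ideal (+ δ))
        (distinct-∤ (γ≢δ ∘ sym) δ<q γ<q ∘ subst (+ q ∣_) (det-conic-ideal² i (+ γ) (+ δ)))

    -- A scalar relating two points of the
    -- same kind fixes a coordinate equal to 1 in both, hence fixes the others
    -- (unit-scalar); points of different kinds differ in x₀ ∈ {0, 1}.
    conic-conic-distinct : ∀ {i j} → i ≢ j → i < q → j < q → ¬ SamePoint q (conic i) (conic j)
    conic-conic-distinct {i} {j} i≢j i<q j<q (c , _ , q∣x₀ , q∣x₁ , _) =
      distinct-∤ i≢j i<q j<q (unit-scalar c (+ i) (+ j) q∣x₀ q∣x₁)

    ideal-ideal-distinct : ∀ {γ δ} → γ ≢ δ → γ < q → δ < q → ¬ SamePoint q (ideal (+ γ)) (ideal (+ δ))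
    ideal-ideal-distinct {γ} {δ} γ≢δ γ<q δ<q (c , _ , _ , q∣x₁ , q∣x₂) =
      distinct-∤ γ≢δ γ<q δ<q (unit-scalar c (+ γ) (+ δ) q∣x₁ q∣x₂)

    conic-ideal-distinct : ∀ {i γ} → ¬ SamePoint q (conic i) (ideal γ)
    conic-ideal-distinct (c , _ , q∣x₀ , _) =
      small-∤ (s≤s z≤n) (prime⇒1< pq) (subst (+ q ∣_) (identity c) q∣x₀)
      where
      identity : ∀ c → + 1 - c * + 0 ≡ + 1
      identity = solve-∀

    ideal-conic-distinct : ∀ {i γ} → ¬ SamePoint q (ideal γ) (conic i)
    ideal-conic-distinct (c , q∤c , q∣x₀ , _) = q∤c (negate-∣ c (subst (+ q ∣_) (identity c) q∣x₀))
      where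
      identity : ∀ c → + 0 - c * + 1 ≡ - c
      identity = solve-∀

  lookup-++-split : ∀ {A : Set} (xs ys : List A) (i : Fin (length (xs ++ ys))) →
    (Σ (Fin (length xs)) λ j → toℕ i ≡ toℕ j × lookup (xs ++ ys) i ≡ lookup xs j)
    ⊎ (Σ (Fin (length ys)) λ j → toℕ i ≡ length xs ℕ.+ toℕ j × lookup (xs ++ ys) i ≡ lookup ys j)
  lookup-++-split [] ys i = inj₂ (i , refl , refl)
  lookup-++-split (x ∷ xs) ys zero = inj₁ (zero , refl , refl)
  lookup-++-split (x ∷ xs) ys (suc i) with lookup-++-split xs ys i
  ... | inj₁ (j , i≡j , at-j) = inj₁ (suc j , cong suc i≡j , at-j)
  ... | inj₂ (j , i≡j , at-j) = inj₂ (j , cong suc i≡j , at-j)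

  lookup-map-index : ∀ {A B : Set} (f : A → B) (xs : List A) (i : Fin (length (map f xs))) →
    Σ (Fin (length xs)) λ j → toℕ i ≡ toℕ j × lookup (map f xs) i ≡ f (lookup xs j)
  lookup-map-index f (x ∷ xs) zero = zero , refl , refl
  lookup-map-index f (x ∷ xs) (suc i) with lookup-map-index f xs i
  ... | j , i≡j , at-j = suc j , cong suc i≡j , at-j

  distinct⇒sum≢0 : ∀ {i j} → i ≢ j → 0 ≢ i ℕ.+ j
  distinct⇒sum≢0 {zero} {zero} i≢j _ = i≢j refl
  distinct⇒sum≢0 {zero} {suc j} _ ()
  distinct⇒sum≢0 {suc i} _ ()

  distinct⇒sum< : ∀ {H i j} → i ≤ H → j ≤ H → i ≢ j → i ℕ.+ j < H ℕ.+ H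
  distinct⇒sum< {H} {i} {j} i≤H j≤H i≢j with <-cmp i j
  ... | tri< i<j _ _ = +-mono-<-≤ (<-≤-trans i<j j≤H) j≤H
  ... | tri≈ _ i≡j _ = contradiction i≡j i≢j
  ... | tri> _ _ j<i = +-mono-≤-< i≤H (<-≤-trans j<i i≤H)

  module ConicArc {q : ℕ} (pq : Prime q) (H β : ℕ) (0<β : 0 < β) (2H≤β : H ℕ.+ H ≤ β) (β<q : β < q) where

    points : List Point
    points = V H ++ (ideal (+ 0) ∷ ideal (+ β) ∷ [])

    idealValue : Fin 2 → ℕ
    idealValue zero = 0
    idealValue (suc zero) = β

    -- Entry n u: the n-th point of the list is u.
    data Entry : ℕ → Point → Set where
      conicEntry : ∀ n → n ≤ H → Entry n (conic n)
      idealEntry : ∀ k → Entry (suc H ℕ.+ toℕ k) (ideal (+ idealValue k))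

    2H<q : H ℕ.+ H < q
    2H<q = ≤-<-trans 2H≤β β<q

    conic<q : ∀ {n} → n ≤ H → n < q
    conic<q n≤H = ≤-<-trans n≤H (≤-<-trans (m≤m+n _ _) 2H<q)

    idealValue<q : ∀ k → idealValue k < q
    idealValue<q zero = ≤-<-trans z≤n β<q
    idealValue<q (suc zero) = β<q

    β≢0 : β ≢ 0
    β≢0 β≡0 = <⇒≱ 0<β (subst (_≤ 0) (sym β≡0) z≤n)

    idealValue-injective : ∀ {k l} → k ≢ l → idealValue k ≢ idealValue l
    idealValue-injective {zero} {zero} k≢l = contradiction refl k≢l
    idealValue-injective {zero} {suc zero} _ = β≢0 ∘ sym
    idealValue-injective {suc zero} {zero} _ = β≢0
    idealValue-injective {suc zero} {suc zero} k≢l = contradiction refl k≢l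

    idealValue-avoids-chords : ∀ k {i j} → i ≤ H → j ≤ H → i ≢ j → idealValue k ≢ i ℕ.+ j
    idealValue-avoids-chords zero _ _ i≢j = distinct⇒sum≢0 i≢j
    idealValue-avoids-chords (suc zero) i≤H j≤H i≢j β≡i+j =
      <⇒≱ (distinct⇒sum< i≤H j≤H i≢j) (subst (H ℕ.+ H ≤_) β≡i+j 2H≤β)

    ideal-pigeonhole : ∀ (k l m : Fin 2) → k ≢ l → l ≢ m → k ≢ m → ⊥
    ideal-pigeonhole zero zero _ k≢l _ _ = k≢l refl
    ideal-pigeonhole zero (suc zero) zero _ _ k≢m = k≢m refl
    ideal-pigeonhole zero (suc zero) (suc zero) _ l≢m _ = l≢m refl
    ideal-pigeonhole (suc zero) zero zero _ l≢m _ = l≢m refl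
    ideal-pigeonhole (suc zero) zero (suc zero) _ _ k≢m = k≢m refl
    ideal-pigeonhole (suc zero) (suc zero) _ k≢l _ _ = k≢l refl

    ideal-index-injective : ∀ {k l : Fin 2} → suc H ℕ.+ toℕ k ≢ suc H ℕ.+ toℕ l → k ≢ l
    ideal-index-injective ne k≡l = ne (cong (λ k → suc H ℕ.+ toℕ k) k≡l)

    chord<q : ∀ {i j} → i ≤ H → j ≤ H → i ≢ j → i ℕ.+ j < q
    chord<q i≤H j≤H i≢j = <-trans (distinct⇒sum< i≤H j≤H i≢j) 2H<q

    conic²-ideal : ∀ {i j} k → i ≤ H → j ≤ H → i ≢ j →
                   ¬ Collinear q (conic i) (conic j) (ideal (+ idealValue k))
    conic²-ideal k i≤H j≤H i≢j = conic²-ideal-noncollinear pq i≢j (conic<q i≤H) (conic<q j≤H)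
      (idealValue-avoids-chords k i≤H j≤H i≢j) (idealValue<q k) (chord<q i≤H j≤H i≢j)

    conic-ideal² : ∀ {i} k l → k ≢ l → ¬ Collinear q (conic i) (ideal (+ idealValue k)) (ideal (+ idealValue l))
    conic-ideal² k l k≢l = conic-ideal²-noncollinear pq (idealValue-injective k≢l) (idealValue<q k) (idealValue<q l)

    -- No three entries at distinct positions are collinear; the eight kind
    -- patterns reduce to the two mixed configurations by permuting the points.
    entry-noncollinear : ∀ {x y z u v w} → Entry x u → Entry y v → Entry z w →
                         x ≢ y → y ≢ z → x ≢ z → ¬ Collinear q u v w
    entry-noncollinear (conicEntry i i≤H) (conicEntry j j≤H) (conicEntry k k≤H) x≢y y≢z x≢z =
      conic³-noncollinear pq x≢y y≢z x≢z (conic<q i≤H) (conic<q j≤H) (conic<q k≤H)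
    entry-noncollinear (conicEntry i i≤H) (conicEntry j j≤H) (idealEntry k) x≢y _ _ =
      conic²-ideal k i≤H j≤H x≢y
    entry-noncollinear (conicEntry i i≤H) (idealEntry k) (conicEntry j j≤H) _ _ x≢z =
      conic²-ideal k i≤H j≤H x≢z ∘ collinear-swap₂₃
    entry-noncollinear (idealEntry k) (conicEntry i i≤H) (conicEntry j j≤H) _ y≢z _ =
      conic²-ideal k i≤H j≤H y≢z ∘ collinear-swap₂₃ ∘ collinear-swap₁₂
    entry-noncollinear (conicEntry i _) (idealEntry k) (idealEntry l) _ y≢z _ =
      conic-ideal² k l (ideal-index-injective y≢z)
    entry-noncollinear (idealEntry k) (conicEntry i _) (idealEntry l) _ _ x≢z =
      conic-ideal² k l (ideal-index-injective x≢z) ∘ collinear-swap₁₂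
    entry-noncollinear (idealEntry k) (idealEntry l) (conicEntry i _) x≢y _ _ =
      conic-ideal² k l (ideal-index-injective x≢y) ∘ collinear-swap₁₂ ∘ collinear-swap₂₃
    entry-noncollinear (idealEntry k) (idealEntry l) (idealEntry m) x≢y y≢z x≢z _ =
      ideal-pigeonhole k l m (ideal-index-injective x≢y) (ideal-index-injective y≢z) (ideal-index-injective x≢z)

    entry-distinct : ∀ {x y u v} → Entry x u → Entry y v → x ≢ y → ¬ SamePoint q u v
    entry-distinct (conicEntry i i≤H) (conicEntry j j≤H) x≢y = conic-conic-distinct pq x≢y (conic<q i≤H) (conic<q j≤H)
    entry-distinct (conicEntry i _) (idealEntry k) _ = conic-ideal-distinct pq {i} {+ idealValue k}
    entry-distinct (idealEntry k) (conicEntry i _) _ = ideal-conic-distinct pq {i} {+ idealValue k}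
    entry-distinct (idealEntry k) (idealEntry l) x≢y =
      ideal-ideal-distinct pq (idealValue-injective (ideal-index-injective x≢y)) (idealValue<q k) (idealValue<q l)

    -- Every entry has a coordinate equal to 1, so it is a point of PG(2,q).
    entry-isPoint : ∀ {x u} → Entry x u → IsPoint q u
    entry-isPoint (conicEntry _ _) (q∣x₀ , _) = small-∤ (s≤s z≤n) (prime⇒1< pq) q∣x₀
    entry-isPoint (idealEntry _) (_ , q∣x₁ , _) = small-∤ (s≤s z≤n) (prime⇒1< pq) q∣x₁

    length-V : length (V H) ≡ suc H
    length-V = trans (length-map _ (upTo (suc H))) (length-upTo (suc H))

    entry : (i : Fin (length points)) → Entry (toℕ i) (lookup points i)
    entry i with lookup-++-split (V H) (ideal (+ 0) ∷ ideal (+ β) ∷ []) i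
    ... | inj₁ (j , i≡j , at-j) with lookup-map-index conic (upTo (suc H)) j
    ...   | n , j≡n , at-n =
      subst₂ Entry (sym (trans i≡j j≡n))
        (sym (trans at-j (trans at-n (cong conic (lookup-upTo (suc H) n)))))
        (conicEntry (toℕ n) (≤-pred (subst (toℕ n <_) (length-upTo (suc H)) (toℕ<n n))))
    entry i | inj₂ (k , i≡k , at-k) =
      subst₂ Entry (sym (trans i≡k (cong (ℕ._+ toℕ k) length-V))) (sym (trans at-k (ideal-lookup k)))
        (idealEntry k)
      where
      ideal-lookup : ∀ k → lookup (ideal (+ 0) ∷ ideal (+ β) ∷ []) k ≡ ideal (+ idealValue k)
      ideal-lookup zero = refl
      ideal-lookup (suc zero) = refl

    isArc : IsKArc q (H ℕ.+ 3) points
    isArc = trans (length-++ (V H)) (trans (cong (ℕ._+ 2) length-V) (sym (+-suc H 2)))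
          , (λ i → entry-isPoint (entry i))
          , (λ i j i≢j → entry-distinct (entry i) (entry j) (i≢j ∘ toℕ-injective))
          , (λ i j k i≢j j≢k i≢k → entry-noncollinear (entry i) (entry j) (entry k)
               (i≢j ∘ toℕ-injective) (j≢k ∘ toℕ-injective) (i≢k ∘ toℕ-injective))

open import Data.Nat using (ℕ; _≤_; _+_; _∸_; _/_; _%_)
open import Data.Nat.Primality using (Prime)
open import Relation.Binary.PropositionalEquality using (_≡_)
open import Data.Nat using (zero; suc; _<_; _*_; _≟_; z≤n; s≤s)
open import Data.Nat.Properties
  using (≤-trans; ≤-reflexive; m≤m+n; +-mono-≤; +-monoʳ-≤; *-monoʳ-≤; *-comm; ∸-monoˡ-≤; +-identityʳ; module ≤-Reasoning)
open import Data.Nat.DivMod using (m/n*n≤m; /-monoˡ-≤)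
open import Data.Nat.Tactic.RingSolver using (solve-∀)
open import Relation.Binary.PropositionalEquality using (cong; sym)
open import Relation.Nullary using (yes; no)

-- For q ≥ 19 the lower bound gives H ≥ ⌊(q-1)/3⌋ ≥ ⌊3/3⌋ = 1.
H-positive : ∀ {q H} → 19 ≤ q → (q ∸ 1) / 3 ≤ H → 1 ≤ H
H-positive 19≤q lower = ≤-trans (/-monoˡ-≤ 3 (∸-monoˡ-≤ 1 (≤-trans (m≤m+n 4 15) 19≤q))) lower

H+H≡2H : ∀ H → H + H ≡ 2 * H
H+H≡2H H = cong (H +_) (sym (+-identityʳ H))

-- b_H ∈ {2H, 2H+1}, so the ideal point T_H avoids every chord value i + j < 2H.
2H≤b : ∀ q H → H + H ≤ b q H
2H≤b q H with H ≟ (q ∸ 1) / 3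
... | yes _ = ≤-trans (≤-reflexive (H+H≡2H H)) (m≤m+n (2 * H) 1)
... | no _ = ≤-reflexive (H+H≡2H H)

-- b_H < q: if H = ⌊(q-1)/3⌋ then 2H + 1 ≤ 3H ≤ q - 1, otherwise 2H ≤ 2⌊(q-1)/2⌋ ≤ q - 1.
b<q : ∀ q H → 1 ≤ H → H ≤ (q ∸ 1) / 2 → b q H < q
b<q zero _ (s≤s _) ()
b<q (suc k) H 1≤H upper with H ≟ k / 3
... | yes H≡k/3 = s≤s (begin
  2 * H + 1     ≤⟨ +-monoʳ-≤ (2 * H) 1≤H ⟩
  2 * H + H     ≡⟨ 2H+H≡3H H ⟩
  H * 3         ≡⟨ cong (_* 3) H≡k/3 ⟩
  (k / 3) * 3   ≤⟨ m/n*n≤m k 3 ⟩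
  k             ∎)
  where
  open ≤-Reasoning
  2H+H≡3H : ∀ H → 2 * H + H ≡ H * 3
  2H+H≡3H = solve-∀
... | no _ = s≤s (begin
  2 * H         ≤⟨ *-monoʳ-≤ 2 upper ⟩
  2 * (k / 2)   ≡⟨ *-comm 2 (k / 2) ⟩
  (k / 2) * 2   ≤⟨ m/n*n≤m k 2 ⟩
  k             ∎)
  where open ≤-Reasoning

theorem9 : (q H : ℕ) → Prime q → q % 2 ≡ 1 → 19 ≤ q →
    (q ∸ 1) / 3 ≤ H → H ≤ (q ∸ 1) / 2 →
    IsKArc q (H + 3) (K q H)
-- K_H is, by definition, the list of ConicArc for β = b_H.
theorem9 q H pq _ 19≤q lower upper =
  ConicArcs.ConicArc.isArc pq H (b q H) 0<b (2H≤b q H) (b<q q H 1≤H upper)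
  where
  1≤H : 1 ≤ H
  1≤H = H-positive 19≤q lower

  0<b : 0 < b q H
  0<b = ≤-trans (+-mono-≤ 1≤H z≤n) (2H≤b q H)
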